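{- Let $t\geqslant 0$ be an integer and let $H$ be a Hadamard matrix of order $n=8t+4$ such that every quadruple of distinct rows of $H$ has type $1$ or $t$. Then $n\in\{4,12,20\}$.
   Context: A Hadamard matrix of order $n$ is an $n\times n$ matrix $H=(h_{uv})$ with entries in $\{ -1,1\}$ such that $HH^\top=nI$. For four distinct rows $i,j,k,\ell$ of $H$, put $P_{ijk\ell}=\left|\sum_{r=1}^n h_{ir}h_{jr}h_{kr}h_{\ell r}\right|$; the type of the quadruple $\{i,j,k,\ell\}$ is $T_{ijk\ell}=\frac{n-P_{ijk\ell}}{8}$. -}

module Defs where

open import Data.Nat using (ℕ; zero; suc)
open import Data.Fin using (Fin; zero; suc)
open import Data.Integer using (ℤ; _+_; _*_; +_; -_; ∣_∣; 0ℤ; 1ℤ; -1ℤ)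
open import Data.Sum using (_⊎_)
open import Data.Product using (_×_)
open import Relation.Binary.PropositionalEquality using (_≡_; _≢_)

sumFin : (n : ℕ) → (Fin n → ℤ) → ℤ
sumFin zero    f = 0ℤ
sumFin (suc n) f = f zero + sumFin n (λ r → f (suc r))

Matrix : ℕ → Set
Matrix n = Fin n → Fin n → ℤ

IsHadamard : (n : ℕ) → Matrix n → Set
IsHadamard n H =
  ((u v : Fin n) → (H u v ≡ 1ℤ) ⊎ (H u v ≡ -1ℤ)) ×
  ((i j : Fin n) →
     sumFin n (λ r → H i r * H j r) ≡ (if-eq i j))
  where
    open import Data.Fin using (_≟_)
    open import Relation.Nullary using (yes; no)
    if-eq : Fin n → Fin n → ℤ
    if-eq i j with i ≟ j
    ... | yes _ = + n
    ... | no  _ = 0ℤ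

P : (n : ℕ) → Matrix n → Fin n → Fin n → Fin n → Fin n → ℕ
P n H i j k l = ∣ sumFin n (λ r → H i r * H j r * H k r * H l r) ∣

-- The quadruple {i,j,k,l} has type T, i.e. T = (n - P)/8, stated
-- without division as  n = P + 8 T  (in ℕ; T ≥ 0 since P ≤ n).
HasType : (n : ℕ) → Matrix n → Fin n → Fin n → Fin n → Fin n → ℕ → Set
HasType n H i j k l T = n ≡ P n H i j k l Data.Nat.+ 8 Data.Nat.* T
  where import Data.Nat

Distinct4 : {n : ℕ} → Fin n → Fin n → Fin n → Fin n → Set
Distinct4 i j k l =
  i ≢ j × i ≢ k × i ≢ l × j ≢ k × j ≢ l × k ≢ l

-- For t ≥ 3 the quadruples of type 1, i.e. with |Σᵣ hᵢᵣhⱼᵣhₖᵣhₗᵣ| = n − 8, are the blocks of a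
-- Steiner quadruple system on the rows in which two blocks through a common pair have their
-- symmetric difference as a block.  Both properties come from the inequality
-- |Q(i,j,k,l)| + |Q(i,j,p,s)| ≤ n + |Q(k,l,p,s)| for the signed sums Q, obtained by comparing the
-- sign vectors of the two quadruples entry by entry; the existence of blocks comes from the
-- orthogonality of the columns, which gives Σₛ Q(i,j,k,s)² = n².  The blocks are then the
-- zero-sum quadruples of an elementary abelian 2-group structure on the rows, so the orbits of
-- a subgroup of order 8 partition the rows and 8 ∣ n, contradicting n = 8t + 4.
module Submission where

open import Defs
open import Algebra.Structures using (IsAbelianGroup)
open import Data.Nat using (ℕ; _<_)
open import Data.Fin using (Fin)
open import Data.Sum using (_⊎_)
open import Function using (id)
open import Relation.Binary.PropositionalEquality using (_≡_)

module IntegerSums where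

  open import Data.Nat as ℕ using (zero; suc)
  open import Data.Fin using (zero; suc; punchIn; punchOut)
  open import Data.Fin.Properties using (punchIn-punchOut; punchInᵢ≢i)
  open import Data.Integer using (ℤ; _+_; _*_; +_; -[1+_]; 0ℤ; 1ℤ; _≤_; +≤+)
  open import Data.Integer.Properties
    using ( +-*-semiring; +-0-abelianGroup; pos-*; suc-*; *-zeroʳ; *-identityʳ
          ; ≤-refl; ≤-antisym; +-mono-≤; +-monoʳ-≤; +-identityˡ; +-identityʳ)
  open import Function using (_∘_)
  open import Relation.Binary.PropositionalEquality

  open import Algebra.Properties.Semiring.Sum +-*-semiring public
    using (sum; sum-cong-≗; ∑-distrib-+; ∑-comm; *-distribˡ-sum; *-distribʳ-sum)
  open import Algebra.Properties.Semiring.Sum +-*-semiring using (sum-remove)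
  open import Algebra.Properties.AbelianGroup +-0-abelianGroup using (∙-cancelˡ)

  sumFin≡sum : ∀ n (f : Fin n → ℤ) → sumFin n f ≡ sum f
  sumFin≡sum zero    f = refl
  sumFin≡sum (suc n) f = cong (_+_ (f zero)) (sumFin≡sum n (f ∘ suc))

  sum-const : ∀ n (c : ℤ) → sum {n} (λ _ → c) ≡ + n * c
  sum-const zero    c = refl
  sum-const (suc n) c = trans (cong (_+_ c) (sum-const n c)) (sym (suc-* (+ n) c))

  sum-zero : ∀ n → sum {n} (λ _ → 0ℤ) ≡ 0ℤ
  sum-zero n = trans (sum-const n 0ℤ) (*-zeroʳ (+ n))

  sum-one : ∀ n → sum {n} (λ _ → 1ℤ) ≡ + n
  sum-one n = trans (sum-const n 1ℤ) (*-identityʳ (+ n))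

  sum-mono-≤ : ∀ {n} {f g : Fin n → ℤ} → (∀ r → f r ≤ g r) → sum f ≤ sum g
  sum-mono-≤ {zero}  f≤g = ≤-refl
  sum-mono-≤ {suc n} f≤g = +-mono-≤ (f≤g zero) (sum-mono-≤ (f≤g ∘ suc))

  square-nonneg : ∀ x → 0ℤ ≤ x * x
  square-nonneg (+ k)    = subst (0ℤ ≤_) (pos-* k k) (+≤+ ℕ.z≤n)
  square-nonneg -[1+ k ] = +≤+ ℕ.z≤n

  sum-nonneg-≡0 : ∀ {n} {f : Fin n → ℤ} → (∀ r → 0ℤ ≤ f r) → sum f ≡ 0ℤ → ∀ r → f r ≡ 0ℤ
  sum-nonneg-≡0 {suc n} {f} 0≤f Σf≡0 = λ
    { zero    → f₀≡0
    ; (suc r) → sum-nonneg-≡0 (0≤f ∘ suc) rest≡0 r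
    }
    where
    rest : ℤ
    rest = sum (f ∘ suc)
    0≤rest : 0ℤ ≤ rest
    0≤rest = subst (_≤ rest) (sum-zero n) (sum-mono-≤ (0≤f ∘ suc))
    f₀≤0 : f zero ≤ 0ℤ
    f₀≤0 = subst₂ _≤_ (+-identityʳ (f zero)) Σf≡0 (+-monoʳ-≤ (f zero) 0≤rest)
    f₀≡0 : f zero ≡ 0ℤ
    f₀≡0 = ≤-antisym f₀≤0 (0≤f zero)
    rest≡0 : rest ≡ 0ℤ
    rest≡0 = trans (sym (+-identityˡ rest)) (subst (λ x → x + rest ≡ 0ℤ) f₀≡0 Σf≡0)

  sum-nonneg-≡-term : ∀ {n} {f : Fin n → ℤ} → (∀ s → 0ℤ ≤ f s) →
    ∀ r → sum f ≡ f r → ∀ s → s ≢ r → f s ≡ 0ℤ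
  sum-nonneg-≡-term {suc n} {f} 0≤f r Σf≡fr s s≢r = begin
    f s                           ≡⟨ cong f (punchIn-punchOut r≢s) ⟨
    f (punchIn r (punchOut r≢s))  ≡⟨ sum-nonneg-≡0 (0≤f ∘ punchIn r) rest≡0 (punchOut r≢s) ⟩
    0ℤ                            ∎
    where
    open ≡-Reasoning
    r≢s : r ≢ s
    r≢s = ≢-sym s≢r
    rest≡0 : sum (f ∘ punchIn r) ≡ 0ℤ
    rest≡0 = ∙-cancelˡ (f r) _ _ (trans (sym (sum-remove f)) (trans Σf≡fr (sym (+-identityʳ (f r)))))

  sum-concentrated : ∀ {n} (f : Fin n → ℤ) r → (∀ s → s ≢ r → f s ≡ 0ℤ) → sum f ≡ f r
  sum-concentrated {suc n} f r f≡0 = begin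
    sum f                      ≡⟨ sum-remove f ⟩
    f r + sum (f ∘ punchIn r)
      ≡⟨ cong (_+_ (f r)) (sum-cong-≗ (λ s → f≡0 (punchIn r s) (punchInᵢ≢i r s))) ⟩
    f r + sum {n} (λ _ → 0ℤ)   ≡⟨ cong (_+_ (f r)) (sum-zero n) ⟩
    f r + 0ℤ                   ≡⟨ +-identityʳ (f r) ⟩
    f r                        ∎
    where open ≡-Reasoning

module SignVectors where

  open IntegerSums
  open import Data.Nat as ℕ using ()
  open import Data.Integer using (ℤ; _+_; _*_; -_; +_; -[1+_]; ∣_∣; 1ℤ; -1ℤ; _≤_; -≤+)
  open import Data.Integer.Properties
    using (≤-refl; +-monoʳ-≤; *-identityˡ; -1*i≡-i; ∣-i∣≡∣i∣; pos-+; drop‿+≤+; module ≤-Reasoning)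
  open import Data.Integer.Tactic.RingSolver using (solve-∀)
  open import Data.Product using (∃; _×_; _,_)
  open import Data.Sum using (inj₁; inj₂)
  open import Relation.Binary.PropositionalEquality

  IsSign : ℤ → Set
  IsSign x = x ≡ 1ℤ ⊎ x ≡ -1ℤ

  sign-* : ∀ {x y} → IsSign x → IsSign y → IsSign (x * y)
  sign-* (inj₁ refl) (inj₁ refl) = inj₁ refl
  sign-* (inj₁ refl) (inj₂ refl) = inj₂ refl
  sign-* (inj₂ refl) (inj₁ refl) = inj₂ refl
  sign-* (inj₂ refl) (inj₂ refl) = inj₁ refl

  sign-square : ∀ {x} → IsSign x → x * x ≡ 1ℤ
  sign-square (inj₁ refl) = refl
  sign-square (inj₂ refl) = refl

  -- (1 − x)(1 − y) ≥ 0
  sign-+≤1+* : ∀ {x y} → IsSign x → IsSign y → x + y ≤ 1ℤ + x * y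
  sign-+≤1+* (inj₁ refl) (inj₁ refl) = ≤-refl
  sign-+≤1+* (inj₁ refl) (inj₂ refl) = ≤-refl
  sign-+≤1+* (inj₂ refl) (inj₁ refl) = ≤-refl
  sign-+≤1+* (inj₂ refl) (inj₂ refl) = -≤+

  i≤∣i∣ : ∀ x → x ≤ + ∣ x ∣
  i≤∣i∣ (+ k)    = ≤-refl
  i≤∣i∣ -[1+ k ] = -≤+

  sign-*≤∣∣ : ∀ {ε} → IsSign ε → ∀ x → ε * x ≤ + ∣ x ∣
  sign-*≤∣∣ (inj₁ refl) x = subst (_≤ + ∣ x ∣) (sym (*-identityˡ x)) (i≤∣i∣ x)
  sign-*≤∣∣ (inj₂ refl) x = subst₂ _≤_ (sym (-1*i≡-i x)) (cong +_ (∣-i∣≡∣i∣ x)) (i≤∣i∣ (- x))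

  ∃sign-*≡∣∣ : ∀ x → ∃ λ ε → IsSign ε × ε * x ≡ + ∣ x ∣
  ∃sign-*≡∣∣ (+ k)        = 1ℤ , inj₁ refl , *-identityˡ (+ k)
  ∃sign-*≡∣∣ x@(-[1+ k ]) = -1ℤ , inj₂ refl , -1*i≡-i x

  sum-signs-square : ∀ {n} (x : Fin n → ℤ) → (∀ r → IsSign (x r)) → sum (λ r → x r * x r) ≡ + n
  sum-signs-square {n} x sx = trans (sum-cong-≗ (λ r → sign-square (sx r))) (sum-one n)

  ∣sum∣+∣sum∣≤n+∣sum-*∣ : ∀ {n} (x y : Fin n → ℤ) → (∀ r → IsSign (x r)) → (∀ r → IsSign (y r)) →
    ∣ sum x ∣ ℕ.+ ∣ sum y ∣ ℕ.≤ n ℕ.+ ∣ sum (λ r → x r * y r) ∣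
  ∣sum∣+∣sum∣≤n+∣sum-*∣ {n} x y sx sy with ∃sign-*≡∣∣ (sum x) | ∃sign-*≡∣∣ (sum y)
  ... | ε , sε , εΣx | δ , sδ , δΣy = drop‿+≤+ (begin
    + (∣ sum x ∣ ℕ.+ ∣ sum y ∣)                ≡⟨ pos-+ ∣ sum x ∣ ∣ sum y ∣ ⟩
    + ∣ sum x ∣ + + ∣ sum y ∣                  ≡⟨ cong₂ _+_ (sym εΣx) (sym δΣy) ⟩
    ε * sum x + δ * sum y                      ≡⟨ cong₂ _+_ (*-distribˡ-sum ε x) (*-distribˡ-sum δ y) ⟩
    sum (λ r → ε * x r) + sum (λ r → δ * y r)  ≡⟨ ∑-distrib-+ (λ r → ε * x r) (λ r → δ * y r) ⟨
    sum (λ r → ε * x r + δ * y r)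
      ≤⟨ sum-mono-≤ (λ r → sign-+≤1+* (sign-* sε (sx r)) (sign-* sδ (sy r))) ⟩
    sum (λ r → 1ℤ + ε * x r * (δ * y r))       ≡⟨ ∑-distrib-+ {n} (λ _ → 1ℤ) _ ⟩
    sum {n} (λ _ → 1ℤ) + sum (λ r → ε * x r * (δ * y r))
      ≡⟨ cong₂ _+_ (sum-one n) (sum-cong-≗ (λ r → regroup ε δ (x r) (y r))) ⟩
    + n + sum (λ r → ε * δ * (x r * y r))      ≡⟨ cong (_+_ (+ n)) (*-distribˡ-sum {n} (ε * δ) _) ⟨
    + n + ε * δ * sum (λ r → x r * y r)        ≤⟨ +-monoʳ-≤ (+ n) (sign-*≤∣∣ (sign-* sε sδ) _) ⟩
    + n + + ∣ sum (λ r → x r * y r) ∣          ≡⟨ pos-+ n _ ⟨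
    + (n ℕ.+ ∣ sum (λ r → x r * y r) ∣)        ∎)
    where
    open ≤-Reasoning
    regroup : ∀ a b c d → a * c * (b * d) ≡ a * b * (c * d)
    regroup = solve-∀

module Orthogonality where

  open IntegerSums
  open import Data.Integer using (ℤ; _*_; 0ℤ)
  open import Data.Integer.Properties using (*-comm; *-assoc; *-zeroʳ)
  open import Data.Integer.Tactic.RingSolver using (solve-∀)
  open import Relation.Binary.PropositionalEquality

  parseval : ∀ {m k} (M : Fin m → Fin k → ℤ) (c : ℤ) →
    (∀ l → sum (λ s → M l s * M l s) ≡ c) →
    (∀ l l' → l ≢ l' → sum (λ s → M l s * M l' s) ≡ 0ℤ) →
    (a : Fin m → ℤ) →
    sum (λ s → sum (λ l → a l * M l s) * sum (λ l → a l * M l s)) ≡ c * sum (λ l → a l * a l)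
  parseval {m} {k} M c norm orth a = begin
    sum (λ s → X s * X s)
      ≡⟨ sum-cong-≗ (λ s → *-distribʳ-sum (X s) (λ l → a l * M l s)) ⟩
    sum (λ s → sum (λ l → a l * M l s * X s))  ≡⟨ ∑-comm (λ s l → a l * M l s * X s) ⟩
    sum (λ l → sum (λ s → a l * M l s * X s))
      ≡⟨ sum-cong-≗ (λ l → trans (sum-cong-≗ (λ s → *-assoc (a l) (M l s) (X s)))
                                 (pull-out (a l) (λ s → M l s * X s))) ⟩
    sum (λ l → a l * sum (λ s → M l s * X s))  ≡⟨ sum-cong-≗ (λ l → cong (a l *_) (coordinate l)) ⟩
    sum (λ l → a l * (c * a l))                ≡⟨ sum-cong-≗ (λ l → regroup (a l) c) ⟩
    sum (λ l → c * (a l * a l))                ≡⟨ *-distribˡ-sum c (λ l → a l * a l) ⟨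
    c * sum (λ l → a l * a l)                  ∎
    where
    open ≡-Reasoning
    X : Fin k → ℤ
    X s = sum (λ l → a l * M l s)
    regroup : ∀ x y → x * (y * x) ≡ y * (x * x)
    regroup = solve-∀
    swap : ∀ x y z → x * (y * z) ≡ y * (x * z)
    swap = solve-∀
    pull-out : ∀ x (y : Fin k → ℤ) → sum (λ s → x * y s) ≡ x * sum y
    pull-out x y = sym (*-distribˡ-sum x y)
    coordinate : ∀ l → sum (λ s → M l s * X s) ≡ c * a l
    coordinate l = begin
      sum (λ s → M l s * X s)
        ≡⟨ sum-cong-≗ (λ s → *-distribˡ-sum (M l s) (λ l' → a l' * M l' s)) ⟩
      sum (λ s → sum (λ l' → M l s * (a l' * M l' s)))
        ≡⟨ ∑-comm (λ s l' → M l s * (a l' * M l' s)) ⟩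
      sum (λ l' → sum (λ s → M l s * (a l' * M l' s)))
        ≡⟨ sum-cong-≗ (λ l' → trans (sum-cong-≗ (λ s → swap (M l s) (a l') (M l' s)))
                                    (pull-out (a l') (λ s → M l s * M l' s))) ⟩
      sum (λ l' → a l' * sum (λ s → M l s * M l' s))
        ≡⟨ sum-concentrated (λ l' → a l' * sum (λ s → M l s * M l' s)) l
             (λ l' l'≢l → trans (cong (a l' *_) (orth l l' (≢-sym l'≢l))) (*-zeroʳ (a l'))) ⟩
      a l * sum (λ s → M l s * M l s)  ≡⟨ cong (a l *_) (norm l) ⟩
      a l * c                          ≡⟨ *-comm (a l) c ⟩
      c * a l                          ∎

module HadamardMatrices (n : ℕ) (H : Matrix n) (hadamard : IsHadamard n H) where

  open IntegerSums
  open SignVectors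
  open Orthogonality
  open import Data.Nat as ℕ using ()
  open import Data.Fin using (_≟_)
  open import Data.Integer using (ℤ; _*_; +_; ∣_∣; 0ℤ; 1ℤ)
  open import Data.Integer.Properties using (*-identityˡ; i*j≡0⇒i≡0∨j≡0)
  open import Data.Integer.Tactic.RingSolver using (solve-∀)
  open import Data.Empty using (⊥-elim)
  open import Data.Product using (proj₁; proj₂)
  open import Data.Sum using ([_,_]′)
  open import Relation.Binary.PropositionalEquality
  open import Relation.Nullary using (yes; no)

  entry-sign : ∀ u v → IsSign (H u v)
  entry-sign = proj₁ hadamard

  row-norm : ∀ i → sum (λ r → H i r * H i r) ≡ + n
  row-norm i = sum-signs-square (H i) (entry-sign i)

  row-orth : ∀ i j → i ≢ j → sum (λ r → H i r * H j r) ≡ 0ℤ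
  row-orth i j i≢j with i ≟ j | proj₂ hadamard i j
  ... | yes i≡j | _       = ⊥-elim (i≢j i≡j)
  ... | no _    | ⟨i,j⟩≡0 = trans (sym (sumFin≡sum n _)) ⟨i,j⟩≡0

  column-norm : ∀ r → sum (λ l → H l r * H l r) ≡ + n
  column-norm r = sum-signs-square (λ l → H l r) (λ l → entry-sign l r)

  -- By Parseval for the rows, the squares of column r of HᵀH sum to n², already the square of its
  -- diagonal entry.
  column-orth : ∀ r s → r ≢ s → sum (λ l → H l r * H l s) ≡ 0ℤ
  column-orth r s r≢s =
    square≡0 (sum-nonneg-≡-term (λ s → square-nonneg (C s)) r Σ≡diagonal s (≢-sym r≢s))
    where
    C : Fin n → ℤ
    C s = sum (λ l → H l r * H l s)
    Σ≡diagonal : sum (λ s → C s * C s) ≡ C r * C r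
    Σ≡diagonal = trans (parseval H (+ n) row-norm row-orth (λ l → H l r))
                       (cong (_* C r) (sym (column-norm r)))
    square≡0 : C s * C s ≡ 0ℤ → C s ≡ 0ℤ
    square≡0 eq = [ id , id ]′ (i*j≡0⇒i≡0∨j≡0 (C s) eq)

  Q : Fin n → Fin n → Fin n → Fin n → ℤ
  Q i j k l = sum (λ r → H i r * H j r * H k r * H l r)

  P≡∣Q∣ : ∀ i j k l → P n H i j k l ≡ ∣ Q i j k l ∣
  P≡∣Q∣ i j k l = cong ∣_∣ (sumFin≡sum n _)

  Q-swap₁₂ : ∀ i j k l → Q i j k l ≡ Q j i k l
  Q-swap₁₂ i j k l = sum-cong-≗ (λ r → swap (H i r) (H j r) (H k r) (H l r))
    where swap : ∀ a b c d → a * b * c * d ≡ b * a * c * d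
          swap = solve-∀

  Q-swap₂₃ : ∀ i j k l → Q i j k l ≡ Q i k j l
  Q-swap₂₃ i j k l = sum-cong-≗ (λ r → swap (H i r) (H j r) (H k r) (H l r))
    where swap : ∀ a b c d → a * b * c * d ≡ a * c * b * d
          swap = solve-∀

  Q-swap₃₄ : ∀ i j k l → Q i j k l ≡ Q i j l k
  Q-swap₃₄ i j k l = sum-cong-≗ (λ r → swap (H i r) (H j r) (H k r) (H l r))
    where swap : ∀ a b c d → a * b * c * d ≡ a * b * d * c
          swap = solve-∀

  Q-swap₁₃₂₄ : ∀ i j k l → Q i j k l ≡ Q k l i j
  Q-swap₁₃₂₄ i j k l = sum-cong-≗ (λ r → swap (H i r) (H j r) (H k r) (H l r))
    where swap : ∀ a b c d → a * b * c * d ≡ c * d * a * b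
          swap = solve-∀

  Q-repeated : ∀ i k l → Q i i k l ≡ sum (λ r → H k r * H l r)
  Q-repeated i k l = sum-cong-≗ (λ r → begin
    H i r * H i r * H k r * H l r    ≡⟨ regroup (H i r) (H k r) (H l r) ⟩
    H i r * H i r * (H k r * H l r)  ≡⟨ cong (_* (H k r * H l r)) (sign-square (entry-sign i r)) ⟩
    1ℤ * (H k r * H l r)             ≡⟨ *-identityˡ _ ⟩
    H k r * H l r                    ∎)
    where
    open ≡-Reasoning
    regroup : ∀ a c d → a * a * c * d ≡ a * a * (c * d)
    regroup = solve-∀

  Q-repeated-≢ : ∀ i k l → k ≢ l → Q i i k l ≡ 0ℤ
  Q-repeated-≢ i k l k≢l = trans (Q-repeated i k l) (row-orth k l k≢l)

  Q-repeated-≡ : ∀ i k → Q i i k k ≡ + n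
  Q-repeated-≡ i k = trans (Q-repeated i k k) (row-norm k)

  triple-sign : ∀ i j k r → IsSign (H i r * H j r * H k r)
  triple-sign i j k r = sign-* (sign-* (entry-sign i r) (entry-sign j r)) (entry-sign k r)

  ∣Q∣+∣Q∣≤n+∣Q∣ : ∀ i j k l p s → ∣ Q i j k l ∣ ℕ.+ ∣ Q i j p s ∣ ℕ.≤ n ℕ.+ ∣ Q k l p s ∣
  ∣Q∣+∣Q∣≤n+∣Q∣ i j k l p s =
    subst (λ x → ∣ Q i j k l ∣ ℕ.+ ∣ Q i j p s ∣ ℕ.≤ n ℕ.+ ∣ x ∣) (sum-cong-≗ product)
      (∣sum∣+∣sum∣≤n+∣sum-*∣ _ _ (λ r → sign-* (triple-sign i j k r) (entry-sign l r))
                                 (λ r → sign-* (triple-sign i j p r) (entry-sign s r)))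
    where
    regroup : ∀ a b c d e f → a * b * c * d * (a * b * e * f) ≡ a * a * (b * b) * (c * d * e * f)
    regroup = solve-∀
    product : ∀ r → H i r * H j r * H k r * H l r * (H i r * H j r * H p r * H s r)
                  ≡ H k r * H l r * H p r * H s r
    product r = begin
      H i r * H j r * H k r * H l r * (H i r * H j r * H p r * H s r)
        ≡⟨ regroup (H i r) (H j r) (H k r) (H l r) (H p r) (H s r) ⟩
      H i r * H i r * (H j r * H j r) * (H k r * H l r * H p r * H s r)
        ≡⟨ cong₂ (λ a b → a * b * (H k r * H l r * H p r * H s r))
                 (sign-square (entry-sign i r)) (sign-square (entry-sign j r)) ⟩
      1ℤ * 1ℤ * (H k r * H l r * H p r * H s r)
        ≡⟨ *-identityˡ _ ⟩
      H k r * H l r * H p r * H s r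
        ∎
      where open ≡-Reasoning

  Q-parseval : ∀ i j k → sum (λ s → Q i j k s * Q i j k s) ≡ + n * + n
  Q-parseval i j k = trans
    (parseval (λ r s → H s r) (+ n) column-norm column-orth (λ r → H i r * H j r * H k r))
    (cong (+ n *_) (sum-signs-square _ (triple-sign i j k)))

module BooleanQuadrupleSystems where

  open import Data.Empty using (⊥-elim)
  open import Data.Fin using (_≟_)
  open import Data.Product using (∃; _×_; _,_; proj₁; proj₂)
  open import Data.Sum using (inj₁; inj₂)
  open import Function using (_∘_)
  open import Relation.Binary.PropositionalEquality
  open import Relation.Nullary using (yes; no)

  record IsBooleanSQS {n : ℕ} (Block : Fin n → Fin n → Fin n → Fin n → Set) : Set where
    field
      swap₁₂   : ∀ {i j k l} → Block i j k l → Block j i k l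
      swap₂₃   : ∀ {i j k l} → Block i j k l → Block i k j l
      swap₃₄   : ∀ {i j k l} → Block i j k l → Block i j l k
      distinct : ∀ {i j k l} → Block i j k l → i ≢ j
      unique   : ∀ {i j k l l'} → Block i j k l → Block i j k l' → l ≡ l'
      complete : ∀ {i j k} → i ≢ j → i ≢ k → j ≢ k → ∃ (Block i j k)
      boolean  : ∀ {i j k l p s} → Block i j k l → Block i j p s →
                 k ≢ p → k ≢ s → l ≢ p → l ≢ s → Block k l p s

    swap₁₃₂₄ : ∀ {i j k l} → Block i j k l → Block k l i j
    swap₁₃₂₄ = swap₂₃ ∘ swap₃₄ ∘ swap₁₂ ∘ swap₂₃

  -- Any point o is the zero of a Boolean group whose zero-sum quadruples of distinct points are
  -- the blocks.
  module BooleanGroup {n : ℕ} {Block : Fin n → Fin n → Fin n → Fin n → Set}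
                      (sqs : IsBooleanSQS Block) (o : Fin n) where

    open IsBooleanSQS sqs

    -- w + x + y + z = 0 in the group under construction
    ZeroSum : Fin n → Fin n → Fin n → Fin n → Set
    ZeroSum w x y z = Block w x y z ⊎ (w ≡ x × y ≡ z) ⊎ (w ≡ y × x ≡ z) ⊎ (w ≡ z × x ≡ y)

    pattern pair₁₂ = inj₂ (inj₁ (refl , refl))
    pattern pair₁₃ = inj₂ (inj₂ (inj₁ (refl , refl)))
    pattern pair₁₄ = inj₂ (inj₂ (inj₂ (refl , refl)))

    zs-swap₁₂ : ∀ {w x y z} → ZeroSum w x y z → ZeroSum x w y z
    zs-swap₁₂ (inj₁ b) = inj₁ (swap₁₂ b)
    zs-swap₁₂ pair₁₂   = pair₁₂
    zs-swap₁₂ pair₁₃   = pair₁₄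
    zs-swap₁₂ pair₁₄   = pair₁₃

    zs-swap₂₃ : ∀ {w x y z} → ZeroSum w x y z → ZeroSum w y x z
    zs-swap₂₃ (inj₁ b) = inj₁ (swap₂₃ b)
    zs-swap₂₃ pair₁₂   = pair₁₃
    zs-swap₂₃ pair₁₃   = pair₁₂
    zs-swap₂₃ pair₁₄   = pair₁₄

    zs-pair : ∀ {x y z} → ZeroSum x x y z → y ≡ z
    zs-pair (inj₁ b)                = ⊥-elim (distinct b refl)
    zs-pair (inj₂ (inj₁ (_ , y≡z))) = y≡z
    zs-pair pair₁₃                  = refl
    zs-pair pair₁₄                  = refl

    -- (a + b + c + d) + (a + b + e + f) = c + d + e + f
    zs-trans : ∀ {a b c d e f} → ZeroSum a b c d → ZeroSum a b e f → ZeroSum c d e f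
    zs-trans {c = c} {d} {e} {f} (inj₁ b₁) (inj₁ b₂) with c ≟ e | c ≟ f | d ≟ e | d ≟ f
    ... | yes refl | _        | _        | _        = inj₂ (inj₂ (inj₁ (refl , unique b₁ b₂)))
    ... | no _     | yes refl | _        | _        = inj₂ (inj₂ (inj₂ (refl , unique b₁ (swap₃₄ b₂))))
    ... | no _     | no _     | yes refl | _        = inj₂ (inj₂ (inj₂ (unique (swap₃₄ b₁) b₂ , refl)))
    ... | no _     | no _     | no _     | yes refl =
      inj₂ (inj₂ (inj₁ (unique (swap₃₄ b₁) (swap₃₄ b₂) , refl)))
    ... | no c≢e   | no c≢f   | no d≢e   | no d≢f   = inj₁ (boolean b₁ b₂ c≢e c≢f d≢e d≢f)
    zs-trans (inj₁ b) (inj₂ (inj₁ (refl , _))) = ⊥-elim (distinct b refl)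
    zs-trans (inj₁ b) pair₁₃ = inj₁ (swap₁₃₂₄ b)
    zs-trans (inj₁ b) pair₁₄ = inj₁ (swap₃₄ (swap₁₃₂₄ b))
    zs-trans pair₁₂ z with zs-pair z
    ... | refl = pair₁₂
    zs-trans pair₁₃ z = z
    zs-trans pair₁₄ z = zs-swap₁₂ z

    ∃-completion : ∀ x y → ∃ (ZeroSum o x y)
    ∃-completion x y with x ≟ y | x ≟ o | y ≟ o
    ... | yes refl | _        | _        = o , pair₁₄
    ... | no _     | yes refl | _        = y , pair₁₂
    ... | no _     | no _     | yes refl = x , pair₁₃
    ... | no x≢y   | no x≢o   | no y≢o   with complete (≢-sym x≢o) (≢-sym y≢o) x≢y
    ...   | z , b = z , inj₁ b

    infixl 6 _⊕_
    _⊕_ : Fin n → Fin n → Fin n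
    x ⊕ y = proj₁ (∃-completion x y)

    zs-⊕ : ∀ x y → ZeroSum o x y (x ⊕ y)
    zs-⊕ x y = proj₂ (∃-completion x y)

    ⊕-characterisation : ∀ {x y z} → ZeroSum o x y z → x ⊕ y ≡ z
    ⊕-characterisation {x} {y} z = zs-pair (zs-swap₂₃ (zs-trans (zs-⊕ x y) z))

    ⊕-comm : ∀ x y → x ⊕ y ≡ y ⊕ x
    ⊕-comm x y = ⊕-characterisation {x} {y} (zs-swap₂₃ (zs-⊕ y x))

    ⊕-identityˡ : ∀ x → o ⊕ x ≡ x
    ⊕-identityˡ x = ⊕-characterisation {o} {x} pair₁₂

    ⊕-identityʳ : ∀ x → x ⊕ o ≡ x
    ⊕-identityʳ x = ⊕-characterisation {x} {o} pair₁₃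

    ⊕-self : ∀ x → x ⊕ x ≡ o
    ⊕-self x = ⊕-characterisation {x} {x} pair₁₄

    ⊕-assoc : ∀ x y z → x ⊕ y ⊕ z ≡ x ⊕ (y ⊕ z)
    ⊕-assoc x y z = sym (⊕-characterisation {x} {y ⊕ z} (zs-swap₁₂ (zs-swap₂₃ x,y⊕z,o,x⊕y⊕z)))
      where
      x,x⊕y,z,y⊕z : ZeroSum x (x ⊕ y) z (y ⊕ z)
      x,x⊕y,z,y⊕z = zs-trans (zs-swap₁₂ (zs-swap₂₃ (zs-⊕ x y))) (zs-swap₁₂ (zs-⊕ y z))
      x,y⊕z,o,x⊕y⊕z : ZeroSum x (y ⊕ z) o (x ⊕ y ⊕ z)
      x,y⊕z,o,x⊕y⊕z = zs-trans (zs-swap₂₃ (zs-swap₁₂ x,x⊕y,z,y⊕z)) (zs-swap₂₃ (zs-swap₁₂ (zs-⊕ (x ⊕ y) z)))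

    isBooleanGroup : IsAbelianGroup _≡_ _⊕_ o id
    isBooleanGroup = record
      { isGroup = record
        { isMonoid = record
          { isSemigroup = record
            { isMagma = record { isEquivalence = isEquivalence ; ∙-cong = cong₂ _⊕_ }
            ; assoc   = ⊕-assoc
            }
          ; identity = ⊕-identityˡ , ⊕-identityʳ
          }
        ; inverse = ⊕-self , ⊕-self
        ; ⁻¹-cong = id
        }
      ; comm = ⊕-comm
      }

module BlocksOfTwoTypeHadamard (n : ℕ) (H : Matrix n) (hadamard : IsHadamard n H) (20<n : 20 < n)
  (two-types : ∀ i j k l → Distinct4 i j k l → HasType n H i j k l 1 ⊎ P n H i j k l ≡ 4) where

  open HadamardMatrices n H hadamard
  open IntegerSums using (sum-const; sum-mono-≤)
  open BooleanQuadrupleSystems using (IsBooleanSQS)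
  open import Data.Nat using (_+_; _*_; _≤_; z≤n; >-nonZero; _≟_)
  open import Data.Nat.Properties
    using ( ≤-trans; ≤-<-trans; <⇒≱; ≤-reflexive; +-cancelˡ-≤; +-monoˡ-≤; m≤m+n; m+1+n≢m
          ; *-cancelˡ-≤; module ≤-Reasoning)
  open import Data.Nat.Tactic.RingSolver using (solve-∀)
  open import Data.Fin using () renaming (_≟_ to _≟ᶠ_)
  open import Data.Fin.Properties using (any?)
  open import Data.Integer as ℤ using (+_; -[1+_]; ∣_∣; 0ℤ)
  open import Data.Integer.Properties using (pos-*; drop‿+≤+) renaming (≤-reflexive to ≤ᶻ-reflexive)
  open import Data.Empty using (⊥-elim)
  open import Data.Product using (∃; _,_)
  open import Data.Sum using (inj₁; inj₂)
  open import Relation.Binary.PropositionalEquality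
  open import Relation.Nullary using (¬_; yes; no)

  Block : Fin n → Fin n → Fin n → Fin n → Set
  Block i j k l = n ≡ ∣ Q i j k l ∣ + 8

  Block-cong : ∀ {i j k l i' j' k' l'} → Q i j k l ≡ Q i' j' k' l' → Block i j k l → Block i' j' k' l'
  Block-cong = subst (λ x → n ≡ ∣ x ∣ + 8)

  block-or-∣Q∣≡4 : ∀ i j k l → Distinct4 i j k l → Block i j k l ⊎ ∣ Q i j k l ∣ ≡ 4
  block-or-∣Q∣≡4 i j k l d with two-types i j k l d
  ... | inj₁ type-1 = inj₁ (trans type-1 (cong (_+ 8) (P≡∣Q∣ i j k l)))
  ... | inj₂ P≡4    = inj₂ (trans (sym (P≡∣Q∣ i j k l)) P≡4)

  n≰ : ∀ {m} → m ≤ 20 → ¬ n ≤ m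
  n≰ m≤20 n≤m = <⇒≱ 20<n (≤-trans n≤m m≤20)

  blocks-meet : ∀ {i j k l p s} → Block i j k l → Block i j p s → n ≤ ∣ Q k l p s ∣ + 16
  blocks-meet {i} {j} {k} {l} {p} {s} b b' = +-cancelˡ-≤ n _ _ (begin
    n + n                                      ≡⟨ cong₂ _+_ b b' ⟩
    (∣ Q i j k l ∣ + 8) + (∣ Q i j p s ∣ + 8)  ≡⟨ regroup ∣ Q i j k l ∣ ∣ Q i j p s ∣ ⟩
    (∣ Q i j k l ∣ + ∣ Q i j p s ∣) + 16       ≤⟨ +-monoˡ-≤ 16 (∣Q∣+∣Q∣≤n+∣Q∣ i j k l p s) ⟩
    (n + ∣ Q k l p s ∣) + 16                   ≡⟨ reassociate n ∣ Q k l p s ∣ ⟩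
    n + (∣ Q k l p s ∣ + 16)                   ∎)
    where
    open ≤-Reasoning
    regroup : ∀ a b → (a + 8) + (b + 8) ≡ (a + b) + 16
    regroup = solve-∀
    reassociate : ∀ a b → (a + b) + 16 ≡ a + (b + 16)
    reassociate = solve-∀

  no-repeated-block : ∀ {i k l} → ¬ Block i i k l
  no-repeated-block {i} {k} {l} b with k ≟ᶠ l
  ... | yes refl = m+1+n≢m n (sym (trans b (cong (λ x → ∣ x ∣ + 8) (Q-repeated-≡ i k))))
  ... | no k≢l   = n≰ (m≤m+n 8 12) (≤-reflexive (trans b (cong (λ x → ∣ x ∣ + 8) (Q-repeated-≢ i k l k≢l))))

  block-distinct : ∀ {i j k l} → Block i j k l → i ≢ j
  block-distinct b refl = no-repeated-block b

  unique : ∀ {i j k l l'} → Block i j k l → Block i j k l' → l ≡ l'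
  unique {i} {j} {k} {l} {l'} b b' with l ≟ᶠ l'
  ... | yes l≡l' = l≡l'
  ... | no l≢l'  = ⊥-elim (n≰ (m≤m+n 16 4) (subst (λ x → n ≤ ∣ x ∣ + 16) Q≡0 (blocks-meet b b')))
    where Q≡0 : Q k l k l' ≡ 0ℤ
          Q≡0 = trans (Q-swap₂₃ k l k l') (Q-repeated-≢ k l l' l≢l')

  boolean : ∀ {i j k l p s} → Block i j k l → Block i j p s →
            k ≢ p → k ≢ s → l ≢ p → l ≢ s → Block k l p s
  boolean {i} {j} {k} {l} {p} {s} b b' k≢p k≢s l≢p l≢s
    with block-or-∣Q∣≡4 k l p s (k≢l , k≢p , k≢s , l≢p , l≢s , p≢s)
    where k≢l : k ≢ l
          k≢l = block-distinct (Block-cong (Q-swap₁₃₂₄ i j k l) b)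
          p≢s : p ≢ s
          p≢s = block-distinct (Block-cong (Q-swap₁₃₂₄ i j p s) b')
  ... | inj₁ block = block
  ... | inj₂ ∣Q∣≡4 = ⊥-elim (n≰ (m≤m+n 20 0) (subst (λ x → n ≤ x + 16) ∣Q∣≡4 (blocks-meet b b')))

  -- Otherwise every Q(i,j,k,s)² is 0 or 16, against Σₛ Q(i,j,k,s)² = n².
  complete : ∀ {i j k} → i ≢ j → i ≢ k → j ≢ k → ∃ (Block i j k)
  complete {i} {j} {k} i≢j i≢k j≢k with any? (λ l → n ≟ ∣ Q i j k l ∣ + 8)
  ... | yes block = block
  ... | no  none  = ⊥-elim (n≰ (m≤m+n 16 4) (*-cancelˡ-≤ n {{>-nonZero (≤-<-trans z≤n 20<n)}} n*n≤n*16))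
    where
    zero²≤16 : ∀ {x} → x ≡ 0ℤ → x ℤ.* x ℤ.≤ + 16
    zero²≤16 refl = ℤ.+≤+ z≤n
    ∣x∣≡4⇒x²≡16 : ∀ x → ∣ x ∣ ≡ 4 → x ℤ.* x ≡ + 16
    ∣x∣≡4⇒x²≡16 (+ _)    refl = refl
    ∣x∣≡4⇒x²≡16 -[1+ _ ] refl = refl
    square≤16 : ∀ s → Q i j k s ℤ.* Q i j k s ℤ.≤ + 16
    square≤16 s with s ≟ᶠ i | s ≟ᶠ j | s ≟ᶠ k
    ... | yes refl | _ | _ = zero²≤16
      (trans (Q-swap₃₄ i j k i) (trans (Q-swap₂₃ i j i k) (Q-repeated-≢ i j k j≢k)))
    ... | no _ | yes refl | _ = zero²≤16
      (trans (Q-swap₃₄ i j k j)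
        (trans (Q-swap₁₂ i j j k) (trans (Q-swap₂₃ j i j k) (Q-repeated-≢ j i k i≢k))))
    ... | no _ | no _ | yes refl = zero²≤16
      (trans (Q-swap₁₃₂₄ i j k k) (Q-repeated-≢ k i j i≢j))
    ... | no s≢i | no s≢j | no s≢k
      with block-or-∣Q∣≡4 i j k s (i≢j , i≢k , ≢-sym s≢i , j≢k , ≢-sym s≢j , ≢-sym s≢k)
    ...   | inj₁ block = ⊥-elim (none (s , block))
    ...   | inj₂ ∣Q∣≡4 = ≤ᶻ-reflexive (∣x∣≡4⇒x²≡16 (Q i j k s) ∣Q∣≡4)
    n*n≤n*16 : n * n ≤ n * 16
    n*n≤n*16 = drop‿+≤+ (subst₂ ℤ._≤_
      (trans (Q-parseval i j k) (sym (pos-* n n)))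
      (trans (sum-const n (+ 16)) (sym (pos-* n 16)))
      (sum-mono-≤ square≤16))

  isBooleanSQS : IsBooleanSQS Block
  isBooleanSQS = record
    { swap₁₂   = Block-cong (Q-swap₁₂ _ _ _ _)
    ; swap₂₃   = Block-cong (Q-swap₂₃ _ _ _ _)
    ; swap₃₄   = Block-cong (Q-swap₃₄ _ _ _ _)
    ; distinct = block-distinct
    ; unique   = unique
    ; complete = complete
    ; boolean  = boolean
    }

module NaturalSums where

  open import Data.Nat using (zero; suc; _+_; _*_; _<?_)
  open import Data.Nat.Properties
    using (+-*-semiring; <-asym; ≮⇒≥; ≤-antisym; *-identityˡ; *-distribʳ-+; +-identityʳ)
  open import Data.Fin.Permutation using (permutation)
  open import Data.Empty using (⊥-elim)
  open import Relation.Binary.PropositionalEquality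
  open import Relation.Nullary using (yes; no)

  open import Algebra.Properties.Semiring.Sum +-*-semiring public
    using (sum; sum-cong-≗; ∑-distrib-+)
  open import Algebra.Properties.Semiring.Sum +-*-semiring using (sum-permute)

  sum-ones : ∀ n → sum {n} (λ _ → 1) ≡ n
  sum-ones zero    = refl
  sum-ones (suc n) = cong suc (sum-ones n)

  sum-involution : ∀ {n} (σ : Fin n → Fin n) → (∀ x → σ (σ x) ≡ x) → (f : Fin n → ℕ) →
    sum (λ x → f (σ x)) ≡ sum f
  sum-involution σ σσ f = sym (sum-permute f (permutation σ σ σσ σσ))

  χ[_<_] : ℕ → ℕ → ℕ
  χ[ a < b ] with a <? b
  ... | yes _ = 1
  ... | no  _ = 0

  χ[<]+χ[>]≡1 : ∀ {a b} → a ≢ b → χ[ a < b ] + χ[ b < a ] ≡ 1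
  χ[<]+χ[>]≡1 {a} {b} a≢b with a <? b | b <? a
  ... | yes a<b | yes b<a = ⊥-elim (<-asym a<b b<a)
  ... | yes _   | no _    = refl
  ... | no _    | yes _   = refl
  ... | no a≮b  | no b≮a  = ⊥-elim (a≢b (≤-antisym (≮⇒≥ b≮a) (≮⇒≥ a≮b)))

  -- Each pair {x, σ x} is counted once, at the end where the key κ is smaller.
  sum-halve : ∀ {n} (σ : Fin n → Fin n) → (∀ x → σ (σ x) ≡ x) →
    (κ : Fin n → ℕ) → (∀ x → κ x ≢ κ (σ x)) →
    (f : Fin n → ℕ) → (∀ x → f (σ x) ≡ f x) →
    sum f ≡ 2 * sum (λ x → χ[ κ x < κ (σ x) ] * f x)
  sum-halve {n} σ σσ κ κ≢ f fσ = begin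
    sum f                                         ≡⟨ sum-cong-≗ split ⟩
    sum (λ x → g x + χ[ κ (σ x) < κ x ] * f x)    ≡⟨ ∑-distrib-+ g _ ⟩
    sum g + sum (λ x → χ[ κ (σ x) < κ x ] * f x)  ≡⟨ cong (sum g +_) (sum-cong-≗ gσ) ⟨
    sum g + sum (λ x → g (σ x))                   ≡⟨ cong (sum g +_) (sum-involution σ σσ g) ⟩
    sum g + sum g                                 ≡⟨ cong (sum g +_) (+-identityʳ (sum g)) ⟨
    2 * sum g                                     ∎
    where
    open ≡-Reasoning
    g : Fin n → ℕ
    g x = χ[ κ x < κ (σ x) ] * f x
    split : ∀ x → f x ≡ g x + χ[ κ (σ x) < κ x ] * f x
    split x = begin
      f x                                              ≡⟨ *-identityˡ (f x) ⟨
      1 * f x                                          ≡⟨ cong (_* f x) (χ[<]+χ[>]≡1 (κ≢ x)) ⟨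
      (χ[ κ x < κ (σ x) ] + χ[ κ (σ x) < κ x ]) * f x  ≡⟨ *-distribʳ-+ (f x) χ[ κ x < κ (σ x) ] _ ⟩
      g x + χ[ κ (σ x) < κ x ] * f x                   ∎
    gσ : ∀ x → g (σ x) ≡ χ[ κ (σ x) < κ x ] * f x
    gσ x = cong₂ (λ y z → χ[ κ (σ x) < κ y ] * z) (σσ x) (fσ x)

module FiniteBooleanGroups {n : ℕ} {_⊕_ : Fin n → Fin n → Fin n} {o : Fin n}
                           (isBooleanGroup : IsAbelianGroup _≡_ _⊕_ o id) where

  open NaturalSums
  open import Algebra.Bundles using (AbelianGroup)
  open import Data.Nat using (zero; suc; _+_; _*_; _^_; _≤_; _⊓_)
  open import Data.Nat.Properties
    using (⊓-sel; ⊓-comm; +-identityʳ; <-≤-trans; <⇒≤; <⇒≱; ^-monoʳ-<; n<1+n)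
  open import Data.Nat.Divisibility using (_∣_; 1∣_; *-monoʳ-∣)
  open import Data.Fin using (toℕ; _≟_)
  open import Data.Fin.Properties using (toℕ-injective; ¬∀⟶∃¬; injective⇒≤)
  open import Data.List using (List; []; _∷_; _++_; map; length; lookup)
  open import Data.List.Properties using (length-++; length-map)
  open import Data.List.Membership.Propositional using (_∈_; _∉_)
  open import Data.List.Membership.Propositional.Properties using (∈-++⁺ˡ; ∈-++⁺ʳ; ∈-++⁻; ∈-map⁺; ∈-map⁻)
  open import Data.List.Membership.DecPropositional (_≟_ {n}) using (_∈?_)
  open import Data.List.Relation.Unary.Any using (here; there; index)
  open import Data.List.Relation.Unary.Any.Properties using (lookup-index)
  open import Data.Product using (∃; _×_; _,_)
  open import Data.Sum using (inj₁; inj₂)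
  open import Data.Unit using (⊤; tt)
  open import Relation.Binary.PropositionalEquality

  open IsAbelianGroup isBooleanGroup using (assoc; comm; identityˡ; inverseˡ)

  booleanGroup : AbelianGroup _ _
  booleanGroup = record { isAbelianGroup = isBooleanGroup }

  open import Algebra.Properties.AbelianGroup booleanGroup using (\\-leftDividesˡ; ∙-cancelʳ)

  ⊕-involutive : ∀ g x → g ⊕ (g ⊕ x) ≡ x
  ⊕-involutive = \\-leftDividesˡ

  ⊕-swap : ∀ g h x → g ⊕ (h ⊕ x) ≡ h ⊕ (g ⊕ x)
  ⊕-swap g h x = trans (sym (assoc g h x)) (trans (cong (_⊕ x) (comm g h)) (assoc h g x))

  span : List (Fin n) → List (Fin n)
  span []       = o ∷ []
  span (g ∷ gs) = span gs ++ map (g ⊕_) (span gs)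

  length-span : ∀ gs → length (span gs) ≡ 2 ^ length gs
  length-span []       = refl
  length-span (g ∷ gs) = begin
    length (span gs ++ map (g ⊕_) (span gs))
      ≡⟨ length-++ (span gs) ⟩
    length (span gs) + length (map (g ⊕_) (span gs))
      ≡⟨ cong (length (span gs) +_) (length-map (g ⊕_) (span gs)) ⟩
    length (span gs) + length (span gs)
      ≡⟨ cong₂ _+_ (length-span gs) (length-span gs) ⟩
    2 ^ length gs + 2 ^ length gs
      ≡⟨ cong (2 ^ length gs +_) (+-identityʳ (2 ^ length gs)) ⟨
    2 ^ suc (length gs)
      ∎
    where open ≡-Reasoning

  ∈-span-∷ : ∀ g gs {k x} → k ∈ span gs → x ≡ g ⊕ k → x ∈ span (g ∷ gs)
  ∈-span-∷ g gs k∈ refl = ∈-++⁺ʳ (span gs) (∈-map⁺ (g ⊕_) k∈)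

  span-closed : ∀ gs {k k'} → k ∈ span gs → k' ∈ span gs → (k ⊕ k') ∈ span gs
  span-closed []       (here refl) (here refl) = here (inverseˡ o)
  span-closed (g ∷ gs) {k} {k'} k∈ k'∈ with ∈-++⁻ (span gs) k∈ | ∈-++⁻ (span gs) k'∈
  ... | inj₁ k∈₀ | inj₁ k'∈₀ = ∈-++⁺ˡ (span-closed gs k∈₀ k'∈₀)
  ... | inj₁ k∈₀ | inj₂ k'∈₁ with ∈-map⁻ (g ⊕_) k'∈₁
  ...   | m' , m'∈ , refl = ∈-span-∷ g gs (span-closed gs k∈₀ m'∈) (⊕-swap k g m')
  span-closed (g ∷ gs) {k} {k'} k∈ k'∈ | inj₂ k∈₁ | inj₁ k'∈₀ with ∈-map⁻ (g ⊕_) k∈₁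
  ...   | m , m∈ , refl = ∈-span-∷ g gs (span-closed gs m∈ k'∈₀) (assoc g m k')
  span-closed (g ∷ gs) {k} {k'} k∈ k'∈ | inj₂ k∈₁ | inj₂ k'∈₁ with ∈-map⁻ (g ⊕_) k∈₁ | ∈-map⁻ (g ⊕_) k'∈₁
  ...   | m , m∈ , refl | m' , m'∈ , refl = ∈-++⁺ˡ (subst (_∈ span gs) (sym cancel) (span-closed gs m∈ m'∈))
    where
    cancel : (g ⊕ m) ⊕ (g ⊕ m') ≡ m ⊕ m'
    cancel = begin
      (g ⊕ m) ⊕ (g ⊕ m')  ≡⟨ assoc g m (g ⊕ m') ⟩
      g ⊕ (m ⊕ (g ⊕ m'))  ≡⟨ cong (g ⊕_) (⊕-swap m g m') ⟩
      g ⊕ (g ⊕ (m ⊕ m'))  ≡⟨ ⊕-involutive g (m ⊕ m') ⟩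
      m ⊕ m'              ∎
      where open ≡-Reasoning

  Independent : List (Fin n) → Set
  Independent []       = ⊤
  Independent (g ∷ gs) = g ∉ span gs × Independent gs

  -- the least index in the orbit of x under the subgroup spanned by gs
  orbitMin : List (Fin n) → Fin n → ℕ
  orbitMin []       x = toℕ x
  orbitMin (g ∷ gs) x = orbitMin gs x ⊓ orbitMin gs (g ⊕ x)

  orbitMin-attained : ∀ gs x → ∃ λ k → k ∈ span gs × orbitMin gs x ≡ toℕ (k ⊕ x)
  orbitMin-attained []       x = o , here refl , cong toℕ (sym (identityˡ x))
  orbitMin-attained (g ∷ gs) x with ⊓-sel (orbitMin gs x) (orbitMin gs (g ⊕ x))
  ... | inj₁ eq with orbitMin-attained gs x
  ...   | k , k∈ , attained = k , ∈-++⁺ˡ k∈ , trans eq attained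
  orbitMin-attained (g ∷ gs) x | inj₂ eq with orbitMin-attained gs (g ⊕ x)
  ...   | k , k∈ , attained =
    k ⊕ g , ∈-span-∷ g gs k∈ (comm k g) , trans eq (trans attained (cong toℕ (sym (assoc k g x))))

  orbitMin-invariant : ∀ gs {h} → h ∈ gs → ∀ x → orbitMin gs (h ⊕ x) ≡ orbitMin gs x
  orbitMin-invariant (g ∷ gs) (here refl) x =
    trans (cong (λ y → orbitMin gs (g ⊕ x) ⊓ orbitMin gs y) (⊕-involutive g x)) (⊓-comm _ _)
  orbitMin-invariant (g ∷ gs) {h} (there h∈) x = cong₂ _⊓_
    (orbitMin-invariant gs h∈ x)
    (trans (cong (orbitMin gs) (⊕-swap g h x)) (orbitMin-invariant gs h∈ (g ⊕ x)))

  orbitMin-separates : ∀ gs {g} → g ∉ span gs → ∀ x → orbitMin gs x ≢ orbitMin gs (g ⊕ x)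
  orbitMin-separates gs {g} g∉ x eq with orbitMin-attained gs x | orbitMin-attained gs (g ⊕ x)
  ... | k , k∈ , p | k' , k'∈ , q = g∉ (subst (_∈ span gs) k'⊕k≡g (span-closed gs k'∈ k∈))
    where
    k≡k'⊕g : k ≡ k' ⊕ g
    k≡k'⊕g = ∙-cancelʳ x k (k' ⊕ g)
      (trans (toℕ-injective (trans (sym p) (trans eq q))) (sym (assoc k' g x)))
    k'⊕k≡g : k' ⊕ k ≡ g
    k'⊕k≡g = trans (cong (k' ⊕_) k≡k'⊕g) (⊕-involutive k' g)

  2^length∣sum : ∀ gs → Independent gs →
    (f : Fin n → ℕ) → (∀ {h} → h ∈ gs → ∀ x → f (h ⊕ x) ≡ f x) → 2 ^ length gs ∣ sum f
  2^length∣sum []       _            f _     = 1∣ sum f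
  2^length∣sum (g ∷ gs) (g∉ , indep) f f-inv =
    subst (2 ^ suc (length gs) ∣_) (sym halved) (*-monoʳ-∣ 2 (2^length∣sum gs indep F F-inv))
    where
    F : Fin n → ℕ
    F x = χ[ orbitMin gs x < orbitMin gs (g ⊕ x) ] * f x
    halved : sum f ≡ 2 * sum F
    halved = sum-halve (g ⊕_) (⊕-involutive g) (orbitMin gs) (orbitMin-separates gs g∉)
                       f (f-inv (here refl))
    F-inv : ∀ {h} → h ∈ gs → ∀ x → F (h ⊕ x) ≡ F x
    F-inv {h} h∈ x = cong₂ _*_
      (cong₂ χ[_<_] (orbitMin-invariant gs h∈ x)
                    (trans (cong (orbitMin gs) (⊕-swap g h x)) (orbitMin-invariant gs h∈ (g ⊕ x))))
      (f-inv (there h∈) x)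

  ∃-∉ : (xs : List (Fin n)) → length xs < n → ∃ (_∉ xs)
  ∃-∉ xs len<n = ¬∀⟶∃¬ n (_∈ xs) (_∈? xs) (λ all∈ → <⇒≱ len<n (injective⇒≤ (index-injective all∈)))
    where
    index-injective : (all∈ : ∀ y → y ∈ xs) → ∀ {y y'} → index (all∈ y) ≡ index (all∈ y') → y ≡ y'
    index-injective all∈ {y} {y'} eq =
      trans (lookup-index (all∈ y)) (trans (cong (lookup xs) eq) (sym (lookup-index (all∈ y'))))

  ∃-independent : ∀ k → 2 ^ k ≤ n → ∃ λ gs → Independent gs × length gs ≡ k
  ∃-independent zero    _       = [] , tt , refl
  ∃-independent (suc k) 2^1+k≤n = extend (∃-independent k (<⇒≤ 2^k<n))
    where
    2^k<n : 2 ^ k < n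
    2^k<n = <-≤-trans (^-monoʳ-< 2 (n<1+n 1) (n<1+n k)) 2^1+k≤n
    extend : (∃ λ gs → Independent gs × length gs ≡ k) → ∃ λ gs → Independent gs × length gs ≡ suc k
    extend (gs , indep , refl) with ∃-∉ (span gs) (subst (_< n) (sym (length-span gs)) 2^k<n)
    ... | g , g∉ = g ∷ gs , (g∉ , indep) , refl

  2^k∣order : ∀ k → 2 ^ k ≤ n → 2 ^ k ∣ n
  2^k∣order k 2^k≤n with ∃-independent k 2^k≤n
  ... | gs , indep , refl =
    subst (2 ^ length gs ∣_) (sum-ones n) (2^length∣sum gs indep (λ _ → 1) (λ _ _ → refl))

open import Data.Nat using (suc; _+_; _*_; _≤_; s≤s; z≤n)
open import Data.Nat.Divisibility using (_∣_; ∣m+n∣m⇒∣n; m∣m*n; ∣⇒≤)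
open import Data.Nat.Properties using (+-cancelʳ-≡; +-comm; +-monoˡ-≤; *-monoʳ-≤; ≤-trans; m≤m+n)
open import Data.Empty using (⊥-elim)
open import Data.Sum using (inj₁; inj₂; map₂)
open import Relation.Binary.PropositionalEquality using (refl; trans; sym)
open import Relation.Nullary using (¬_)

8∤8t+4 : ∀ t → ¬ 8 ∣ 8 * t + 4
8∤8t+4 t 8∣8t+4 with ∣⇒≤ (∣m+n∣m⇒∣n 8∣8t+4 (m∣m*n t))
... | s≤s (s≤s (s≤s (s≤s ())))

corollary3p7 : (t : ℕ) → (H : Matrix (8 * t + 4)) →
    IsHadamard (8 * t + 4) H →
    ((i j k l : Fin (8 * t + 4)) → Distinct4 i j k l →
      HasType (8 * t + 4) H i j k l 1 ⊎ HasType (8 * t + 4) H i j k l t) →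
    (8 * t + 4 ≡ 4) ⊎ (8 * t + 4 ≡ 12) ⊎ (8 * t + 4 ≡ 20)
corollary3p7 0 _ _ _ = inj₁ refl
corollary3p7 1 _ _ _ = inj₂ (inj₁ refl)
corollary3p7 2 _ _ _ = inj₂ (inj₂ refl)
corollary3p7 t@(suc (suc (suc _))) H hadamard types = ⊥-elim (8∤8t+4 t (2^k∣order 3 8≤n))
  where
  n : ℕ
  n = 8 * t + 4
  28≤n : 28 ≤ n
  28≤n = +-monoˡ-≤ 4 (*-monoʳ-≤ 8 (s≤s (s≤s (s≤s z≤n))))
  8≤n : 8 ≤ n
  8≤n = ≤-trans (m≤m+n 8 20) 28≤n
  20<n : 20 < n
  20<n = ≤-trans (m≤m+n 21 7) 28≤n
  type-t⇒P≡4 : ∀ {i j k l} → HasType n H i j k l t → P n H i j k l ≡ 4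
  type-t⇒P≡4 n≡P+8t = +-cancelʳ-≡ (8 * t) _ _ (trans (sym n≡P+8t) (+-comm (8 * t) 4))
  open BlocksOfTwoTypeHadamard n H hadamard 20<n (λ i j k l d → map₂ type-t⇒P≡4 (types i j k l d))
    using (isBooleanSQS)
  open BooleanQuadrupleSystems.BooleanGroup isBooleanSQS Data.Fin.zero using (isBooleanGroup)
  open FiniteBooleanGroups isBooleanGroup using (2^k∣order)
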